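{- For every positive integer $n$, $M_n=L_nU_n$, where $M_n=(m_{i,j})_{0\le i,j\le n}$ with $m_{i,j}=\binom{2j+1}{i}-\delta_{2j+1,i}$, $L_n=(l_{i,j})_{0\le i,j\le n}$ with $l_{i,j}=\binom{j}{i-j}$, and $U_n=(u_{i,j})_{0\le i,j\le n}$ with $u_{i,j}=1$ if $i=0$, $u_{i,j}=\binom{2j-i}{i-1}\frac{2j+1}{i}$ if $0<i<2j+1$, and $u_{i,j}=0$ if $i\ge2j+1$.
   Context: $\delta$ is the Kronecker delta; binomial coefficients $\binom{m}{j}$ with $j<0$ or $j>m\ge0$ are zero. -}

module Defs where

open import Data.Nat as ℕ using (ℕ; zero; suc; _∸_; _<ᵇ_)
open import Data.Nat.Combinatorics using (_C_)
open import Data.Fin using (Fin; toℕ)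
open import Data.Bool using (if_then_else_)
open import Data.Integer using (+_)
open import Data.Rational as ℚ using (ℚ; 0ℚ; 1ℚ; _/_; _+_; _*_; _-_)

Mat : ℕ → Set
Mat n = Fin (suc n) → Fin (suc n) → ℚ

∑ : ∀ {m} → (Fin m → ℚ) → ℚ
∑ {zero} f = 0ℚ
∑ {suc m} f = f Data.Fin.zero + ∑ (λ k → f (Data.Fin.suc k))

_⊗_ : ∀ {n} → Mat n → Mat n → Mat n
(A ⊗ B) i j = ∑ (λ k → A i k * B k j)

ι : ℕ → ℚ
ι a = + a / 1

δ : ℕ → ℕ → ℚ
δ a b = if a ℕ.≡ᵇ b then 1ℚ else 0ℚ

-- binom(j, i - j) with the convention that it is 0 when i - j < 0
binomDiff : ℕ → ℕ → ℕ
binomDiff j i = if i <ᵇ j then 0 else j C (i ∸ j)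

mEntry : ℕ → ℕ → ℚ
mEntry i j = ι ((2 ℕ.* j ℕ.+ 1) C i) - δ (2 ℕ.* j ℕ.+ 1) i

lEntry : ℕ → ℕ → ℚ
lEntry i j = ι (binomDiff j i)

uEntry : ℕ → ℕ → ℚ
uEntry zero j = 1ℚ
uEntry (suc i') j =
  if suc i' <ᵇ 2 ℕ.* j ℕ.+ 1
  then ι ((2 ℕ.* j ∸ suc i') C i') * ((+ (2 ℕ.* j ℕ.+ 1)) / suc i')
  else 0ℚ

M : (n : ℕ) → Mat n
M n i j = mEntry (toℕ i) (toℕ j)

L : (n : ℕ) → Mat n
L n i j = lEntry (toℕ i) (toℕ j)

U : (n : ℕ) → Mat n
U n i j = uEntry (toℕ i) (toℕ j)

module Submission where

-- Column j of U_n lists the coefficients of the Lucas polynomial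
-- L_{2j+1}(x), where L_0 = 2, L_1 = 1, L_{N+2} = L_{N+1} + x·L_N, and
-- column k of L_n lists the coefficients of (y + y²)^k.  Hence entry (i, j)
-- of L_n·U_n is the coefficient of y^i in L_{2j+1}(y + y²).  The classical
-- identity L_N(y + y²) = (1 + y)^N + (-y)^N, which holds because both sides
-- satisfy the Lucas recurrence in x = y + y², then gives
-- C(2j+1, i) + [y^i](-y)^(2j+1) = C(2j+1, i) - δ_{2j+1,i}.

open import Defs
open import Data.Nat using (ℕ; suc)
open import Data.Fin using (Fin)
open import Relation.Binary.PropositionalEquality using (_≡_)

open import Algebra.Bundles using (CommutativeMonoid)
import Algebra.Properties.CommutativeSemigroup as CommutativeSemigroupProperties
open import Data.Bool using (true; false; if_then_else_)
open import Data.Bool.Properties using (T-≡; ¬-not)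
open import Data.Fin using (toℕ)
open import Data.Fin.Properties using (toℕ<n)
open import Data.Integer as ℤ using (+_)
import Data.Integer.Properties as ℤ
open import Data.Nat using (zero; _+_; _*_; _∸_; _<_; _≤_; z≤n; s≤s; _<ᵇ_)
open import Data.Nat.Combinatorics using (_C_; nC1≡n; nCk+nC[k+1]≡[n+1]C[k+1]; k>n⇒nCk≡0)
open import Data.Nat.Properties
open import Data.Nat.Tactic.RingSolver using (solve-∀)
open import Data.Rational as ℚ using (ℚ; 0ℚ; 1ℚ; toℚᵘ)
import Data.Rational.Properties as ℚ
import Data.Rational.Solver as ℚ-Solver
open import Data.Rational.Unnormalised as ℚᵘ using (mkℚᵘ; *≡*)
import Data.Rational.Unnormalised.Properties as ℚᵘ
open import Function.Bundles using (Equivalence)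
open import Relation.Binary.PropositionalEquality
  using (_≡_; refl; sym; trans; cong; cong₂; subst; subst₂; module ≡-Reasoning)

open CommutativeSemigroupProperties +-commutativeSemigroup
  using () renaming (interchange to +-interchange)
open CommutativeSemigroupProperties (CommutativeMonoid.commutativeSemigroup ℚ.+-0-commutativeMonoid)
  using () renaming (interchange to ℚ-+-interchange)
open import Algebra.Properties.Group ℚ.+-0-group using () renaming (⁻¹-involutive to neg-involutive)

-- The embedding ι : ℕ → ℚ agrees, after forgetting normalisation, with the
-- fraction a/1; this is how its arithmetic is transported from ℚᵘ.
toℚᵘ-/ : ∀ z s → toℚᵘ (z ℚ./ suc s) ℚᵘ.≃ mkℚᵘ z s
toℚᵘ-/ z s = ℚ.toℚᵘ-fromℚᵘ (mkℚᵘ z s)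

ι-+ : ∀ a b → ι (a + b) ≡ ι a ℚ.+ ι b
ι-+ a b = ℚ.toℚᵘ-injective (begin
  toℚᵘ (ι (a + b))                   ≈⟨ toℚᵘ-/ (+ (a + b)) 0 ⟩
  mkℚᵘ (+ (a + b)) 0                 ≈⟨ *≡* (cong (ℤ._* + 1) integer-sum) ⟩
  mkℚᵘ (+ a) 0 ℚᵘ.+ mkℚᵘ (+ b) 0     ≈⟨ ℚᵘ.+-cong (toℚᵘ-/ (+ a) 0) (toℚᵘ-/ (+ b) 0) ⟨
  toℚᵘ (ι a) ℚᵘ.+ toℚᵘ (ι b)         ≈⟨ ℚ.toℚᵘ-homo-+ (ι a) (ι b) ⟨
  toℚᵘ (ι a ℚ.+ ι b)                 ∎)
  where
  open ℚᵘ.≃-Reasoning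
  integer-sum : + (a + b) ≡ + a ℤ.* + 1 ℤ.+ + b ℤ.* + 1
  integer-sum = trans (ℤ.pos-+ a b) (sym (cong₂ ℤ._+_ (ℤ.*-identityʳ (+ a)) (ℤ.*-identityʳ (+ b))))

ι-*-/ : ∀ c N s t → suc s * t ≡ N * c → ι c ℚ.* (+ N ℚ./ suc s) ≡ ι t
ι-*-/ c N s t eq = ℚ.toℚᵘ-injective unnormalised
  where
  cross : c * N * 1 ≡ t * (1 * suc s)
  cross = begin
    c * N * 1        ≡⟨ *-identityʳ (c * N) ⟩
    c * N            ≡⟨ *-comm c N ⟩
    N * c            ≡⟨ eq ⟨
    suc s * t        ≡⟨ *-comm (suc s) t ⟩
    t * suc s        ≡⟨ cong (t *_) (*-identityˡ (suc s)) ⟨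
    t * (1 * suc s)  ∎
    where open ≡-Reasoning
  integer-cross : + c ℤ.* + N ℤ.* + 1 ≡ + t ℤ.* + (1 * suc s)
  integer-cross = begin
    + c ℤ.* + N ℤ.* + 1    ≡⟨ cong (ℤ._* + 1) (ℤ.pos-* c N) ⟨
    + (c * N) ℤ.* + 1      ≡⟨ ℤ.pos-* (c * N) 1 ⟨
    + (c * N * 1)          ≡⟨ cong +_ cross ⟩
    + (t * (1 * suc s))    ≡⟨ ℤ.pos-* t (1 * suc s) ⟩
    + t ℤ.* + (1 * suc s)  ∎
    where open ≡-Reasoning
  unnormalised : toℚᵘ (ι c ℚ.* (+ N ℚ./ suc s)) ℚᵘ.≃ toℚᵘ (ι t)
  unnormalised = begin
    toℚᵘ (ι c ℚ.* (+ N ℚ./ suc s))        ≈⟨ ℚ.toℚᵘ-homo-* (ι c) (+ N ℚ./ suc s) ⟩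
    toℚᵘ (ι c) ℚᵘ.* toℚᵘ (+ N ℚ./ suc s)  ≈⟨ ℚᵘ.*-cong (toℚᵘ-/ (+ c) 0) (toℚᵘ-/ (+ N) s) ⟩
    mkℚᵘ (+ c) 0 ℚᵘ.* mkℚᵘ (+ N) s        ≈⟨ *≡* integer-cross ⟩
    mkℚᵘ (+ t) 0                          ≈⟨ toℚᵘ-/ (+ t) 0 ⟨
    toℚᵘ (ι t)                            ∎
    where open ℚᵘ.≃-Reasoning

sumTo : ℕ → (ℕ → ℚ) → ℚ
sumTo B f = ∑ {B} (λ k → f (toℕ k))

sumTo-cong : ∀ B {f g : ℕ → ℚ} → (∀ k → f k ≡ g k) → sumTo B f ≡ sumTo B g
sumTo-cong zero    f≗g = refl
sumTo-cong (suc B) f≗g = cong₂ ℚ._+_ (f≗g 0) (sumTo-cong B (λ k → f≗g (suc k)))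

sumTo-+ : ∀ B (f g : ℕ → ℚ) → sumTo B (λ k → f k ℚ.+ g k) ≡ sumTo B f ℚ.+ sumTo B g
sumTo-+ zero    f g = refl
sumTo-+ (suc B) f g = trans (cong (f 0 ℚ.+ g 0 ℚ.+_) (sumTo-+ B (λ k → f (suc k)) (λ k → g (suc k))))
                            (ℚ-+-interchange (f 0) (g 0) _ _)

sumTo-zero : ∀ B {f : ℕ → ℚ} → (∀ k → f k ≡ 0ℚ) → sumTo B f ≡ 0ℚ
sumTo-zero zero    f≗0 = refl
sumTo-zero (suc B) f≗0 = cong₂ ℚ._+_ (f≗0 0) (sumTo-zero B (λ k → f≗0 (suc k)))

-- Multiplying a power series by its variable shifts its coefficients up by one.
shift : {A : Set} → A → (ℕ → A) → ℕ → A
shift z f zero    = z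
shift z f (suc i) = f i

-- Absorption identity (k+1)·C(n+1,k+1) = (n+1)·C(n,k), the integral form of
-- C(n+1,k+1) = (n+1)/(k+1) · C(n,k).
absorption : ∀ n k → suc k * (suc n C suc k) ≡ suc n * (n C k)
absorption zero    zero    = refl
absorption zero    (suc k) = *-zeroʳ (suc (suc k))
absorption (suc n) zero    = trans (*-identityˡ (suc (suc n) C 1))
                                   (trans (nC1≡n (suc (suc n))) (sym (*-identityʳ (suc (suc n)))))
absorption (suc n) (suc k) = begin
  suc (suc k) * (suc (suc n) C suc (suc k))
    ≡⟨ cong (suc (suc k) *_) (sym (nCk+nC[k+1]≡[n+1]C[k+1] (suc n) (suc k))) ⟩
  suc (suc k) * (x + y)
    ≡⟨ rearrange k x y ⟩
  x + (suc k * x + suc (suc k) * y)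
    ≡⟨ cong (λ z → x + z) (cong₂ _+_ (absorption n k) (absorption n (suc k))) ⟩
  x + (suc n * (n C k) + suc n * (n C suc k))
    ≡⟨ cong (λ z → x + z) (sym (*-distribˡ-+ (suc n) (n C k) (n C suc k))) ⟩
  x + suc n * (n C k + n C suc k)
    ≡⟨ cong (λ z → x + suc n * z) (nCk+nC[k+1]≡[n+1]C[k+1] n k) ⟩
  suc (suc n) * x
    ∎
  where
  open ≡-Reasoning
  x y : ℕ
  x = suc n C suc k
  y = suc n C suc (suc k)
  rearrange : ∀ k x y → suc (suc k) * (x + y) ≡ x + (suc k * x + suc (suc k) * y)
  rearrange = solve-∀

data Position (k : ℕ) : ℕ → Set where
  below : ∀ {i} → i < k → Position k i
  above : ∀ d → Position k (k + d)

position : ∀ k i → Position k i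
position zero    i       = above i
position (suc k) zero    = below (s≤s z≤n)
position (suc k) (suc i) with position k i
... | below i<k = below (s≤s i<k)
... | above d   = above d

<ᵇ-true : ∀ {i k} → i < k → (i <ᵇ k) ≡ true
<ᵇ-true i<k = Equivalence.to T-≡ (<⇒<ᵇ i<k)

<ᵇ-false : ∀ {i k} → k ≤ i → (i <ᵇ k) ≡ false
<ᵇ-false {i} {k} k≤i = ¬-not (λ i<ᵇk → ≤⇒≯ k≤i (<ᵇ⇒< i k (Equivalence.from T-≡ i<ᵇk)))

-- binomDiff k i = C(k, i - k) is the coefficient of y^i in (y + y²)^k.
binomDiff-below : ∀ {k i} → i < k → binomDiff k i ≡ 0
binomDiff-below i<k rewrite <ᵇ-true i<k = refl

binomDiff-above : ∀ k d → binomDiff k (k + d) ≡ k C d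
binomDiff-above k d rewrite <ᵇ-false (m≤m+n k d) | m+n∸m≡n k d = refl

shift-binomDiff-below : ∀ {k i} → i < suc k → shift 0 (binomDiff k) i ≡ 0
shift-binomDiff-below {i = zero}  _         = refl
shift-binomDiff-below {i = suc i} (s≤s i<k) = binomDiff-below i<k

-- (y + y²)^(k+1) = y · ((y + y²)^k + y · (y + y²)^k), coefficientwise.
binomDiff-rec : ∀ k i → binomDiff (suc k) (suc i) ≡ binomDiff k i + shift 0 (binomDiff k) i
binomDiff-rec k i with position k i
... | below i<k = begin
  binomDiff (suc k) (suc i)                       ≡⟨ binomDiff-below (s≤s i<k) ⟩
  0 + 0                                           ≡⟨ cong₂ _+_ (binomDiff-below i<k)
                                                               (shift-binomDiff-below (m<n⇒m<1+n i<k)) ⟨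
  binomDiff k i + shift 0 (binomDiff k) i         ∎
  where open ≡-Reasoning
... | above zero = begin
  binomDiff (suc k) (suc k + 0)                   ≡⟨ binomDiff-above (suc k) 0 ⟩
  1 + 0                                           ≡⟨ cong₂ _+_ (binomDiff-above k 0) shifted ⟨
  binomDiff k (k + 0) + shift 0 (binomDiff k) (k + 0) ∎
  where
  open ≡-Reasoning
  shifted : shift 0 (binomDiff k) (k + 0) ≡ 0
  shifted = trans (cong (shift 0 (binomDiff k)) (+-identityʳ k)) (shift-binomDiff-below (n<1+n k))
... | above (suc d) = begin
  binomDiff (suc k) (suc k + suc d)               ≡⟨ binomDiff-above (suc k) (suc d) ⟩
  suc k C suc d                                   ≡⟨ nCk+nC[k+1]≡[n+1]C[k+1] k d ⟨
  k C d + k C suc d                               ≡⟨ +-comm (k C d) (k C suc d) ⟩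
  k C suc d + k C d                               ≡⟨ cong₂ _+_ (binomDiff-above k (suc d)) shifted ⟨
  binomDiff k (k + suc d) + shift 0 (binomDiff k) (k + suc d) ∎
  where
  open ≡-Reasoning
  shifted : shift 0 (binomDiff k) (k + suc d) ≡ k C d
  shifted = trans (cong (shift 0 (binomDiff k)) (+-suc k d)) (binomDiff-above k d)

-- Coefficients of the Lucas polynomials, L_0 = 2, L_1 = 1 and
-- L_{N+2}(x) = L_{N+1}(x) + x·L_N(x):  lucas N k = [x^k] L_N(x).
lucas : ℕ → ℕ → ℕ
lucas zero          zero    = 2
lucas (suc N)       zero    = 1
lucas zero          (suc k) = 0
lucas (suc zero)    (suc k) = 0
lucas (suc (suc N)) (suc k) = lucas (suc N) (suc k) + lucas N k

lucas-rec : ∀ N k → lucas (suc (suc N)) k ≡ lucas (suc N) k + shift 0 (lucas N) k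
lucas-rec N zero    = refl
lucas-rec N (suc k) = refl

lucas-vanish : ∀ N k → N < k + k → lucas N k ≡ 0
lucas-vanish (suc (suc N)) (suc k) (s≤s N+1<k+k+1) =
  cong₂ _+_ (lucas-vanish (suc N) (suc k) (m≤n⇒m≤1+n N+1<k+k+1))
            (lucas-vanish N k (≤-pred (subst (suc (suc N) ≤_) (+-suc k k) N+1<k+k+1)))
lucas-vanish zero       (suc k) _ = refl
lucas-vanish (suc zero) (suc k) _ = refl

lucas-closed : ∀ k p → lucas (suc (suc (k + (k + p)))) (suc k) ≡ suc (k + p) C suc k + (k + p) C k

-- The same closed form one degree higher, at N = 2k + p + 3 (for p = 0 it
-- reads 0 = 0, as L_{2k+3} has degree k + 1).
lucas-closed-upper : ∀ k p → lucas (suc (suc (k + suc (k + p)))) (suc (suc k))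
                           ≡ suc (k + p) C suc (suc k) + (k + p) C suc k

lucas-closed zero zero    = refl
lucas-closed zero (suc p) = cong (_+ 1) (begin
  lucas (suc (suc p)) 1    ≡⟨ lucas-closed zero p ⟩
  suc p C 1 + 1            ≡⟨ +-comm (suc p C 1) 1 ⟩
  1 + suc p C 1            ≡⟨ nCk+nC[k+1]≡[n+1]C[k+1] (suc p) 0 ⟩
  suc (suc p) C 1          ∎)
  where open ≡-Reasoning
lucas-closed (suc k) p = begin
  lucas (suc (suc (k + suc (k + p)))) (suc (suc k)) + lucas (suc (k + suc (k + p))) (suc k)
    ≡⟨ cong₂ _+_ (lucas-closed-upper k p)
                 (trans (cong (λ N → lucas (suc N) (suc k)) (+-suc k (k + p))) (lucas-closed k p)) ⟩
  (a + b) + (c + d)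
    ≡⟨ +-interchange a b c d ⟩
  (a + c) + (b + d)
    ≡⟨ cong₂ _+_ (trans (+-comm a c) (nCk+nC[k+1]≡[n+1]C[k+1] (suc (k + p)) (suc k)))
                 (trans (+-comm b d) (nCk+nC[k+1]≡[n+1]C[k+1] (k + p) k)) ⟩
  suc (suc k + p) C suc (suc k) + (suc k + p) C suc k
    ∎
  where
  open ≡-Reasoning
  a b c d : ℕ
  a = suc (k + p) C suc (suc k)
  b = (k + p) C suc k
  c = suc (k + p) C suc k
  d = (k + p) C k

lucas-closed-upper k zero = begin
  lucas (suc (suc (k + suc (k + 0)))) (suc (suc k))
    ≡⟨ lucas-vanish _ (suc (suc k)) (≤-reflexive (degree k)) ⟩
  0 + 0
    ≡⟨ cong₂ _+_ (k>n⇒nCk≡0 (s≤s k+0<k+1)) (k>n⇒nCk≡0 k+0<k+1) ⟨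
  suc (k + 0) C suc (suc k) + (k + 0) C suc k
    ∎
  where
  open ≡-Reasoning
  degree : ∀ k → suc (suc (suc (k + suc (k + 0)))) ≡ suc (suc k) + suc (suc k)
  degree = solve-∀
  k+0<k+1 : k + 0 < suc k
  k+0<k+1 = s≤s (≤-reflexive (+-identityʳ k))
lucas-closed-upper k (suc p) = begin
  lucas (suc (suc (k + suc (k + suc p)))) (suc (suc k))
    ≡⟨ cong (λ N → lucas (suc (suc N)) (suc (suc k))) (index k p) ⟩
  lucas (suc (suc (suc k + (suc k + p)))) (suc (suc k))
    ≡⟨ lucas-closed (suc k) p ⟩
  suc (suc k + p) C suc (suc k) + (suc k + p) C suc k
    ≡⟨ cong (λ m → suc m C suc (suc k) + m C suc k) (+-suc k p) ⟨
  suc (k + suc p) C suc (suc k) + (k + suc p) C suc k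
    ∎
  where
  open ≡-Reasoning
  index : ∀ k p → k + suc (k + suc p) ≡ suc k + (suc k + p)
  index = solve-∀

lucas-coefficient : ∀ M k →
  (if suc k <ᵇ suc M then ι ((M ∸ suc k) C k) ℚ.* (+ suc M ℚ./ suc k) else 0ℚ) ≡ ι (lucas (suc M) (suc k))
lucas-coefficient M k with position (suc k) M
... | below M<k+1 rewrite <ᵇ-false (≤-pred M<k+1) =
  cong ι (sym (lucas-vanish (suc M) (suc k) (≤-trans (s≤s M<k+1) (s≤s (m≤n+m (suc k) k)))))
... | above m rewrite <ᵇ-true (s≤s (m≤m+n k m)) | m+n∸m≡n (suc k) m with position k m
...   | below m<k = begin
  ι (m C k) ℚ.* ratio                         ≡⟨ cong (λ c → ι c ℚ.* ratio) (k>n⇒nCk≡0 m<k) ⟩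
  0ℚ ℚ.* ratio                                ≡⟨ ℚ.*-zeroˡ ratio ⟩
  0ℚ                                          ≡⟨ cong ι (lucas-vanish (suc (suc k + m)) (suc k) high) ⟨
  ι (lucas (suc (suc k + m)) (suc k))         ∎
  where
  open ≡-Reasoning
  ratio : ℚ
  ratio = + suc (suc k + m) ℚ./ suc k
  high : suc (suc k + m) < suc k + suc k
  high = subst₂ _≤_ (cong (λ n → suc (suc n)) (+-suc k m)) (cong suc (sym (+-suc k k)))
                    (s≤s (s≤s (+-monoʳ-≤ k m<k)))
...   | above p = trans (ι-*-/ ((k + p) C k) (suc (suc k + (k + p))) k _ scaled)
                      (cong ι (sym (lucas-closed k p)))
  where
  open ≡-Reasoning
  degree : ∀ k p → suc (k + p) + suc k ≡ suc (suc k + (k + p))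
  degree = solve-∀
  scaled : suc k * (suc (k + p) C suc k + (k + p) C k) ≡ suc (suc k + (k + p)) * ((k + p) C k)
  scaled = begin
    suc k * (suc (k + p) C suc k + (k + p) C k)             ≡⟨ *-distribˡ-+ (suc k) _ ((k + p) C k) ⟩
    suc k * (suc (k + p) C suc k) + suc k * ((k + p) C k)   ≡⟨ cong (_+ suc k * ((k + p) C k)) (absorption (k + p) k) ⟩
    suc (k + p) * ((k + p) C k) + suc k * ((k + p) C k)     ≡⟨ *-distribʳ-+ ((k + p) C k) (suc (k + p)) (suc k) ⟨
    (suc (k + p) + suc k) * ((k + p) C k)                   ≡⟨ cong (_* ((k + p) C k)) (degree k p) ⟩
    suc (suc k + (k + p)) * ((k + p) C k)                   ∎

uEntry-lucas : ∀ j k → uEntry k j ≡ ι (lucas (2 * j + 1) k)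
uEntry-lucas j zero    rewrite +-comm (2 * j) 1 = refl
uEntry-lucas j (suc k) rewrite +-comm (2 * j) 1 = lucas-coefficient (2 * j) k

-- Coefficients of (-y)^N.
negPow : ℕ → ℕ → ℚ
negPow zero    zero    = 1ℚ
negPow zero    (suc i) = 0ℚ
negPow (suc N) zero    = 0ℚ
negPow (suc N) (suc i) = ℚ.- negPow N i

-- Coefficients of (1 + y)^N + (-y)^N, which is L_N(y + y²).
powerSum : ℕ → ℕ → ℚ
powerSum N i = ι (N C i) ℚ.+ negPow N i

times-y+y² : (ℕ → ℚ) → ℕ → ℚ
times-y+y² g = shift 0ℚ (λ i → g i ℚ.+ shift 0ℚ g i)

ι-pascal : ∀ n k → ι (suc n C suc k) ≡ ι (n C k) ℚ.+ ι (n C suc k)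
ι-pascal n k = trans (cong ι (sym (nCk+nC[k+1]≡[n+1]C[k+1] n k))) (ι-+ (n C k) (n C suc k))

powerSum-rec : ∀ N i → powerSum (suc (suc N)) i ≡ powerSum (suc N) i ℚ.+ times-y+y² (powerSum N) i
powerSum-rec N zero          = refl
powerSum-rec N (suc zero)    = begin
  ι (suc (suc N) C 1) ℚ.+ ℚ.- 0ℚ
    ≡⟨ cong (ℚ._+ ℚ.- 0ℚ) (ι-pascal (suc N) 0) ⟩
  (1ℚ ℚ.+ ι (suc N C 1)) ℚ.+ ℚ.- 0ℚ
    ≡⟨ rearrange (ι (suc N C 1)) (negPow N 0) ⟩
  (ι (suc N C 1) ℚ.+ ℚ.- negPow N 0) ℚ.+ ((1ℚ ℚ.+ negPow N 0) ℚ.+ 0ℚ)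
    ∎
  where
  open ≡-Reasoning
  open ℚ-Solver.+-*-Solver
  rearrange : ∀ a e → (1ℚ ℚ.+ a) ℚ.+ ℚ.- 0ℚ ≡ (a ℚ.+ ℚ.- e) ℚ.+ ((1ℚ ℚ.+ e) ℚ.+ 0ℚ)
  rearrange = solve 2 (λ a e → (con 1ℚ :+ a) :+ :- con 0ℚ := (a :+ :- e) :+ ((con 1ℚ :+ e) :+ con 0ℚ)) refl
powerSum-rec N (suc (suc i)) = begin
  ι (suc (suc N) C suc (suc i)) ℚ.+ ℚ.- ℚ.- negPow N i
    ≡⟨ cong (ℚ._+ ℚ.- ℚ.- negPow N i)
            (trans (ι-pascal (suc N) (suc i)) (cong (ℚ._+ ι (suc N C suc (suc i))) (ι-pascal N i))) ⟩
  ((ι (N C i) ℚ.+ ι (N C suc i)) ℚ.+ ι (suc N C suc (suc i))) ℚ.+ ℚ.- ℚ.- negPow N i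
    ≡⟨ rearrange (ι (N C i)) (ι (N C suc i)) (ι (suc N C suc (suc i))) (negPow N i) (negPow N (suc i)) ⟩
  (ι (suc N C suc (suc i)) ℚ.+ ℚ.- negPow N (suc i)) ℚ.+ (powerSum N (suc i) ℚ.+ powerSum N i)
    ∎
  where
  open ≡-Reasoning
  open ℚ-Solver.+-*-Solver
  rearrange : ∀ a b c x y → ((a ℚ.+ b) ℚ.+ c) ℚ.+ ℚ.- ℚ.- x ≡ (c ℚ.+ ℚ.- y) ℚ.+ ((b ℚ.+ y) ℚ.+ (a ℚ.+ x))
  rearrange = solve 5 (λ a b c x y → ((a :+ b) :+ c) :+ :- :- x := (c :+ :- y) :+ ((b :+ y) :+ (a :+ x))) refl

negPow-double+1 : ∀ J i → negPow (suc (J + J)) i ≡ ℚ.- δ (suc (J + J)) i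
negPow-double+1 zero    zero          = refl
negPow-double+1 zero    (suc zero)    = refl
negPow-double+1 zero    (suc (suc i)) = refl
negPow-double+1 (suc J) zero          = refl
negPow-double+1 (suc J) (suc zero)    = refl
negPow-double+1 (suc J) (suc (suc i)) rewrite +-suc J J =
  trans (neg-involutive (negPow (suc (J + J)) i)) (negPow-double+1 J i)

negPow-odd : ∀ J i → negPow (2 * J + 1) i ≡ ℚ.- δ (2 * J + 1) i
negPow-odd J i = subst (λ N → negPow N i ≡ ℚ.- δ N i) (sym (odd J)) (negPow-double+1 J i)
  where
  odd : ∀ J → 2 * J + 1 ≡ suc (J + J)
  odd = solve-∀

-- [y^i] of Σ_{k<B} f(k)·(y + y²)^k, i.e. of f(y + y²) when f has fewer than B terms.
substitute : (ℕ → ℕ) → ℕ → ℕ → ℚ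
substitute f B i = sumTo B (λ k → lEntry i k ℚ.* ι (f k))

-- Substitution x ↦ y + y² turns multiplication by x into multiplication by
-- y + y²: if g is the substituted series of f (in degrees below B), then
-- times-y+y² g is the substituted series of x·f (in degrees below B + 1).
substitute-shift : ∀ f g B → (∀ i → i < B → substitute f B i ≡ g i) →
                   ∀ i → i < suc B → substitute (shift 0 f) (suc B) i ≡ times-y+y² g i
substitute-shift f g B subst-f zero _ =
  cong (lEntry 0 0 ℚ.* ι 0 ℚ.+_) (sumTo-zero B (λ k → ℚ.*-zeroˡ (ι (f k))))
substitute-shift f g B subst-f (suc i) (s≤s i<B) = begin
  lEntry (suc i) 0 ℚ.* ι 0 ℚ.+ sumTo B (λ k → lEntry (suc i) (suc k) ℚ.* ι (f k))
    ≡⟨ cong₂ ℚ._+_ (ℚ.*-zeroʳ (lEntry (suc i) 0)) (sumTo-cong B split) ⟩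
  0ℚ ℚ.+ sumTo B (λ k → lEntry i k ℚ.* ι (f k) ℚ.+ lowered k)
    ≡⟨ ℚ.+-identityˡ _ ⟩
  sumTo B (λ k → lEntry i k ℚ.* ι (f k) ℚ.+ lowered k)
    ≡⟨ sumTo-+ B (λ k → lEntry i k ℚ.* ι (f k)) lowered ⟩
  substitute f B i ℚ.+ sumTo B lowered
    ≡⟨ cong₂ ℚ._+_ (subst-f i i<B) (lowered-sum i i<B) ⟩
  g i ℚ.+ shift 0ℚ g i
    ∎
  where
  open ≡-Reasoning
  lowered : ℕ → ℚ
  lowered k = ι (shift 0 (binomDiff k) i) ℚ.* ι (f k)
  split : ∀ k → lEntry (suc i) (suc k) ℚ.* ι (f k) ≡ lEntry i k ℚ.* ι (f k) ℚ.+ lowered k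
  split k = trans (cong (λ c → ι c ℚ.* ι (f k)) (binomDiff-rec k i))
                  (trans (cong (ℚ._* ι (f k)) (ι-+ (binomDiff k i) (shift 0 (binomDiff k) i)))
                         (ℚ.*-distribʳ-+ (ι (f k)) (lEntry i k) (ι (shift 0 (binomDiff k) i))))
  lowered-sum : ∀ j → j < B → sumTo B (λ k → ι (shift 0 (binomDiff k) j) ℚ.* ι (f k)) ≡ shift 0ℚ g j
  lowered-sum zero    _   = sumTo-zero B (λ k → ℚ.*-zeroˡ (ι (f k)))
  lowered-sum (suc j) j<B = subst-f j (<⇒≤ j<B)

-- Both sides obey the
-- Lucas recurrence, so it follows by induction on N.
lucas-substitution : ∀ N B i → i < B → substitute (lucas N) B i ≡ powerSum N i
lucas-substitution N zero i ()
lucas-substitution zero (suc B) i _ =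
  trans (cong (lEntry i 0 ℚ.* ι 2 ℚ.+_) (sumTo-zero B (λ k → ℚ.*-zeroʳ (lEntry i (suc k))))) (constant i)
  where
  constant : ∀ i → lEntry i 0 ℚ.* ι 2 ℚ.+ 0ℚ ≡ powerSum 0 i
  constant zero    = refl
  constant (suc i) = refl
lucas-substitution (suc zero) (suc B) i _ =
  trans (cong (lEntry i 0 ℚ.* ι 1 ℚ.+_) (sumTo-zero B (λ k → ℚ.*-zeroʳ (lEntry i (suc k))))) (constant i)
  where
  constant : ∀ i → lEntry i 0 ℚ.* ι 1 ℚ.+ 0ℚ ≡ powerSum 1 i
  constant zero          = refl
  constant (suc zero)    = refl
  constant (suc (suc i)) = refl
lucas-substitution (suc (suc N)) (suc B) i i<B = begin
  substitute (lucas (suc (suc N))) (suc B) i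
    ≡⟨ sumTo-cong (suc B) split ⟩
  sumTo (suc B) (λ k → lEntry i k ℚ.* ι (lucas (suc N) k) ℚ.+ lEntry i k ℚ.* ι (shift 0 (lucas N) k))
    ≡⟨ sumTo-+ (suc B) (λ k → lEntry i k ℚ.* ι (lucas (suc N) k))
                       (λ k → lEntry i k ℚ.* ι (shift 0 (lucas N) k)) ⟩
  substitute (lucas (suc N)) (suc B) i ℚ.+ substitute (shift 0 (lucas N)) (suc B) i
    ≡⟨ cong₂ ℚ._+_ (lucas-substitution (suc N) (suc B) i i<B)
                   (substitute-shift (lucas N) (powerSum N) B (lucas-substitution N B) i i<B) ⟩
  powerSum (suc N) i ℚ.+ times-y+y² (powerSum N) i
    ≡⟨ powerSum-rec N i ⟨
  powerSum (suc (suc N)) i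
    ∎
  where
  open ≡-Reasoning
  split : ∀ k → lEntry i k ℚ.* ι (lucas (suc (suc N)) k)
              ≡ lEntry i k ℚ.* ι (lucas (suc N) k) ℚ.+ lEntry i k ℚ.* ι (shift 0 (lucas N) k)
  split k = trans (cong (λ c → lEntry i k ℚ.* ι c) (lucas-rec N k))
                  (trans (cong (lEntry i k ℚ.*_) (ι-+ (lucas (suc N) k) (shift 0 (lucas N) k)))
                         (ℚ.*-distribˡ-+ (lEntry i k) (ι (lucas (suc N) k)) (ι (shift 0 (lucas N) k))))

-- Entry (i, j) of L_n·U_n is [y^i] L_{2j+1}(y + y²) = C(2j+1, i) - δ_{2j+1,i}.
-- (The factorisation also holds for n = 0, so the hypothesis 1 ≤ n is unused.)
mainTheorem11 : (n : ℕ) → 1 Data.Nat.≤ n →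
    (i j : Fin (suc n)) → M n i j ≡ (L n ⊗ U n) i j
mainTheorem11 n _ i j = sym (begin
  (L n ⊗ U n) i j
    ≡⟨ sumTo-cong (suc n) (λ k → cong (lEntry I k ℚ.*_) (uEntry-lucas J k)) ⟩
  substitute (lucas (2 * J + 1)) (suc n) I
    ≡⟨ lucas-substitution (2 * J + 1) (suc n) I (toℕ<n i) ⟩
  ι ((2 * J + 1) C I) ℚ.+ negPow (2 * J + 1) I
    ≡⟨ cong (ι ((2 * J + 1) C I) ℚ.+_) (negPow-odd J I) ⟩
  mEntry I J
    ∎)
  where
  open ≡-Reasoning
  I J : ℕ
  I = toℕ i
  J = toℕ j
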